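{- Let $q\ge 1$ and let $j$ be an odd integer. Then $\prod_{i=0}^{2^q-1}(ix-i+j)^2\equiv x^{2^q}\pmod{2^q}$ as polynomials in $x$. -}

module Defs where

open import Data.Nat as ℕ using (ℕ; zero; suc)
open import Data.Integer using (ℤ; +_; _+_; _-_; _*_)
open import Data.Integer.Divisibility using (_∣_)
open import Data.Product using (Σ)
open import Relation.Binary.PropositionalEquality using (_≡_)
open import Data.List using (List; []; _∷_; map; upTo; foldr)

-- Polynomials in one variable x over ℤ, as coefficient lists,
-- lowest degree first: a₀ ∷ a₁ ∷ … represents a₀ + a₁ x + …
Poly : Set
Poly = List ℤ

_+ₚ_ : Poly → Poly → Poly
[]       +ₚ q        = q
(a ∷ p)  +ₚ []       = a ∷ p
(a ∷ p)  +ₚ (b ∷ q)  = (a + b) ∷ (p +ₚ q)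

_·ₚ_ : ℤ → Poly → Poly
c ·ₚ p = map (c *_) p

_*ₚ_ : Poly → Poly → Poly
[]      *ₚ q = []
(a ∷ p) *ₚ q = (a ·ₚ q) +ₚ (+ 0 ∷ (p *ₚ q))

oneₚ : Poly
oneₚ = + 1 ∷ []

xPow : ℕ → Poly
xPow zero    = oneₚ
xPow (suc n) = + 0 ∷ xPow n

coeff : Poly → ℕ → ℤ
coeff []      _       = + 0
coeff (a ∷ p) zero    = a
coeff (a ∷ p) (suc k) = coeff p k

_≡_[modₚ_] : Poly → Poly → ℤ → Set
p ≡ q [modₚ m ] = ∀ k → m ∣ (coeff p k - coeff q k)

prodₚ : List Poly → Poly
prodₚ = foldr _*ₚ_ oneₚ

linFactor : ℤ → ℤ → Poly
linFactor i j = (j - i) ∷ i ∷ []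

sqFactor : ℕ → ℤ → Poly
sqFactor i j = linFactor (+ i) j *ₚ linFactor (+ i) j

Odd : ℤ → Set
Odd j = Σ ℤ (λ k → j ≡ + 2 * k + + 1)

{-# OPTIONS --safe #-}
-- Let Pₙ = ∏_{i<n} (ix - i + j)², with polynomials handled through their coefficient
-- sequences, multiplied by convolution _⊛_. For n = 2 the claim is j² (x - 1 + j)² ≡ x²
-- (mod 2), as j is odd. For even n the claim doubles: replacing i by n + i changes the
-- coefficients of (ix - i + j)² by integer combinations of 2n and n², both divisible by 2n, so
-- P₂ₙ = Pₙ · ∏_{i<n} ((n + i)x - (n + i) + j)² ≡ Pₙ² (mod 2n); and writing Pₙ = xⁿ + D with
-- n ∣ D gives Pₙ² = x²ⁿ + 2xⁿD + D² ≡ x²ⁿ (mod 2n), since 2n ∣ n² ∣ D².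
module Submission where

open import Defs
open import Data.Nat using (ℕ; _≤_; _^_)
open import Data.Integer using (ℤ; +_)
open import Data.List using (map; upTo)

open import Data.Nat as ℕ using (zero; suc)
import Data.Nat.Properties as ℕ
open import Data.Integer using (_+_; _-_; _*_; -_)
import Data.Integer.Properties as ℤ
open import Data.Integer.Divisibility.Signed
  using ( _∣_; divides; ∣-refl; ∣-trans; ∣m∣n⇒∣m+n; ∣m⇒∣-m; ∣n⇒∣m*n; ∣m⇒∣m*n
        ; *-monoˡ-∣; *-monoʳ-∣; ∣⇒∣ᵤ)
open import Data.Integer.Tactic.RingSolver using (solve-∀)
open import Data.List using ([]; _∷_; _++_; applyUpTo)
open import Data.List.Properties using (map-upTo)
open import Data.Product using (_,_)
open import Function using (_∘_)
open import Relation.Binary.Bundles using (Setoid)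
open import Relation.Binary.PropositionalEquality
import Relation.Binary.Reasoning.Setoid as ≈-Reasoning

m∣0 : ∀ m → m ∣ + 0
m∣0 m = divides (+ 0) (sym (ℤ.*-zeroˡ m))

*-pres-∣ : ∀ {a b x y} → a ∣ x → b ∣ y → a * b ∣ x * y
*-pres-∣ {b = b} {x} a∣x b∣y = ∣-trans (*-monoˡ-∣ b a∣x) (*-monoʳ-∣ x b∣y)

∣-double : ∀ {m n} → m ∣ n → m + m ∣ n + n
∣-double {m} (divides q refl) = divides q (sym (ℤ.*-distribˡ-+ q m m))

∣-+-cong : ∀ {m} a a′ b b′ → m ∣ a - a′ → m ∣ b - b′ → m ∣ (a + b) - (a′ + b′)
∣-+-cong {m} a a′ b b′ m∣a-a′ m∣b-b′ =
  subst (m ∣_) (sum-difference a a′ b b′) (∣m∣n⇒∣m+n m∣a-a′ m∣b-b′)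
  where
  sum-difference : ∀ a a′ b b′ → (a - a′) + (b - b′) ≡ (a + b) - (a′ + b′)
  sum-difference = solve-∀

∣-*-cong : ∀ {m} a a′ b b′ → m ∣ a - a′ → m ∣ b - b′ → m ∣ a * b - a′ * b′
∣-*-cong {m} a a′ b b′ m∣a-a′ m∣b-b′ =
  subst (m ∣_) (sym (product-difference a a′ b b′))
    (∣m∣n⇒∣m+n (∣m⇒∣m*n b m∣a-a′) (∣n⇒∣m*n a′ m∣b-b′))
  where
  product-difference : ∀ a a′ b b′ → a * b - a′ * b′ ≡ (a - a′) * b + a′ * (b - b′)
  product-difference = solve-∀

Coeffs : Set
Coeffs = ℕ → ℤ

infix 4 _≈[_]_
_≈[_]_ : Coeffs → ℤ → Coeffs → Set
f ≈[ m ] g = ∀ k → m ∣ f k - g k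

≗⇒≈ : ∀ {m f g} → f ≗ g → f ≈[ m ] g
≗⇒≈ {m} {f} f≗g k = subst (λ z → m ∣ f k - z) (f≗g k)
  (subst (m ∣_) (sym (ℤ.+-inverseʳ (f k))) (m∣0 m))

≈-refl : ∀ {m f} → f ≈[ m ] f
≈-refl {m} {f} = ≗⇒≈ {m} {f} (λ _ → refl)

≈-sym : ∀ {m f g} → f ≈[ m ] g → g ≈[ m ] f
≈-sym {m} {f} {g} f≈g k = subst (m ∣_) (negate-minus (f k) (g k)) (∣m⇒∣-m (f≈g k))
  where
  negate-minus : ∀ a b → - (a - b) ≡ b - a
  negate-minus = solve-∀

≈-trans : ∀ {m f g h} → f ≈[ m ] g → g ≈[ m ] h → f ≈[ m ] h
≈-trans {m} {f} {g} {h} f≈g g≈h k =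
  subst (m ∣_) (telescope (f k) (g k) (h k)) (∣m∣n⇒∣m+n (f≈g k) (g≈h k))
  where
  telescope : ∀ a b c → (a - b) + (b - c) ≡ a - c
  telescope = solve-∀

≈-setoid : ℤ → Setoid _ _
≈-setoid m = record
  { Carrier       = Coeffs
  ; _≈_           = _≈[ m ]_
  ; isEquivalence = record
    { refl  = λ {f} → ≈-refl {m} {f}
    ; sym   = λ {f} {g} → ≈-sym {m} {f} {g}
    ; trans = λ {f} {g} {h} → ≈-trans {m} {f} {g} {h}
    }
  }

infixl 7 _⊛_
_⊛_ : Coeffs → Coeffs → Coeffs
(f ⊛ g) zero    = f 0 * g 0
(f ⊛ g) (suc k) = f 0 * g (suc k) + ((f ∘ suc) ⊛ g) k

⊛-cong : ∀ {f f′ g g′} → f ≗ f′ → g ≗ g′ → f ⊛ g ≗ f′ ⊛ g′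
⊛-cong f≗f′ g≗g′ zero    = cong₂ _*_ (f≗f′ 0) (g≗g′ 0)
⊛-cong f≗f′ g≗g′ (suc k) =
  cong₂ _+_ (cong₂ _*_ (f≗f′ 0) (g≗g′ (suc k))) (⊛-cong (f≗f′ ∘ suc) g≗g′ k)

⊛-zeroˡ : ∀ g → (λ _ → + 0) ⊛ g ≗ (λ _ → + 0)
⊛-zeroˡ g zero    = ℤ.*-zeroˡ (g 0)
⊛-zeroˡ g (suc k) = cong₂ _+_ (ℤ.*-zeroˡ (g (suc k))) (⊛-zeroˡ g k)

⊛-distribʳ-+ : ∀ f g h → (λ i → f i + g i) ⊛ h ≗ (λ k → (f ⊛ h) k + (g ⊛ h) k)
⊛-distribʳ-+ f g h zero    = ℤ.*-distribʳ-+ (h 0) (f 0) (g 0)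
⊛-distribʳ-+ f g h (suc k) = begin
  (f 0 + g 0) * h (suc k) + ((λ i → f (suc i) + g (suc i)) ⊛ h) k
    ≡⟨ cong (_+_ ((f 0 + g 0) * h (suc k))) (⊛-distribʳ-+ (f ∘ suc) (g ∘ suc) h k) ⟩
  (f 0 + g 0) * h (suc k) + (((f ∘ suc) ⊛ h) k + ((g ∘ suc) ⊛ h) k)
    ≡⟨ regroup (f 0) (g 0) (h (suc k)) _ _ ⟩
  (f ⊛ h) (suc k) + (g ⊛ h) (suc k) ∎
  where
  open ≡-Reasoning
  regroup : ∀ a b c x y → (a + b) * c + (x + y) ≡ (a * c + x) + (b * c + y)
  regroup = solve-∀

⊛-distribˡ-+ : ∀ f g h → f ⊛ (λ i → g i + h i) ≗ (λ k → (f ⊛ g) k + (f ⊛ h) k)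
⊛-distribˡ-+ f g h zero    = ℤ.*-distribˡ-+ (f 0) (g 0) (h 0)
⊛-distribˡ-+ f g h (suc k) = begin
  f 0 * (g (suc k) + h (suc k)) + ((f ∘ suc) ⊛ (λ i → g i + h i)) k
    ≡⟨ cong (_+_ (f 0 * (g (suc k) + h (suc k)))) (⊛-distribˡ-+ (f ∘ suc) g h k) ⟩
  f 0 * (g (suc k) + h (suc k)) + (((f ∘ suc) ⊛ g) k + ((f ∘ suc) ⊛ h) k)
    ≡⟨ regroup (f 0) (g (suc k)) (h (suc k)) _ _ ⟩
  (f ⊛ g) (suc k) + (f ⊛ h) (suc k) ∎
  where
  open ≡-Reasoning
  regroup : ∀ a b c x y → a * (b + c) + (x + y) ≡ (a * b + x) + (a * c + y)
  regroup = solve-∀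

⊛-*ˡ : ∀ c f g → (λ i → c * f i) ⊛ g ≗ (λ k → c * (f ⊛ g) k)
⊛-*ˡ c f g zero    = ℤ.*-assoc c (f 0) (g 0)
⊛-*ˡ c f g (suc k) = begin
  c * f 0 * g (suc k) + ((λ i → c * f (suc i)) ⊛ g) k
    ≡⟨ cong (_+_ (c * f 0 * g (suc k))) (⊛-*ˡ c (f ∘ suc) g k) ⟩
  c * f 0 * g (suc k) + c * ((f ∘ suc) ⊛ g) k
    ≡⟨ factor c (f 0) (g (suc k)) _ ⟩
  c * (f ⊛ g) (suc k) ∎
  where
  open ≡-Reasoning
  factor : ∀ c a b x → c * a * b + c * x ≡ c * (a * b + x)
  factor = solve-∀

⊛-assoc : ∀ f g h → (f ⊛ g) ⊛ h ≗ f ⊛ (g ⊛ h)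
⊛-assoc f g h zero    = ℤ.*-assoc (f 0) (g 0) (h 0)
⊛-assoc f g h (suc k) = begin
  f 0 * g 0 * h (suc k) + ((λ i → f 0 * g (suc i) + ((f ∘ suc) ⊛ g) i) ⊛ h) k
    ≡⟨ cong (_+_ (f 0 * g 0 * h (suc k))) (⊛-distribʳ-+ _ _ h k) ⟩
  f 0 * g 0 * h (suc k) + (((λ i → f 0 * g (suc i)) ⊛ h) k + (((f ∘ suc) ⊛ g) ⊛ h) k)
    ≡⟨ cong (_+_ (f 0 * g 0 * h (suc k)))
         (cong₂ _+_ (⊛-*ˡ (f 0) (g ∘ suc) h k) (⊛-assoc (f ∘ suc) g h k)) ⟩
  f 0 * g 0 * h (suc k) + (f 0 * ((g ∘ suc) ⊛ h) k + ((f ∘ suc) ⊛ (g ⊛ h)) k)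
    ≡⟨ regroup (f 0) (g 0) (h (suc k)) _ _ ⟩
  (f ⊛ (g ⊛ h)) (suc k) ∎
  where
  open ≡-Reasoning
  regroup : ∀ a b c y z → a * b * c + (a * y + z) ≡ a * (b * c + y) + z
  regroup = solve-∀

shift : ℕ → Coeffs → Coeffs
shift zero    g k       = g k
shift (suc n) g zero    = + 0
shift (suc n) g (suc k) = shift n g k

xPow-⊛ : ∀ n g → coeff (xPow n) ⊛ g ≗ shift n g
xPow-⊛ zero    g zero    = ℤ.*-identityˡ (g 0)
xPow-⊛ zero    g (suc k) = begin
  + 1 * g (suc k) + ((λ _ → + 0) ⊛ g) k
    ≡⟨ cong₂ _+_ (ℤ.*-identityˡ (g (suc k))) (⊛-zeroˡ g k) ⟩
  g (suc k) + + 0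
    ≡⟨ ℤ.+-identityʳ (g (suc k)) ⟩
  g (suc k) ∎
  where open ≡-Reasoning
xPow-⊛ (suc n) g zero    = ℤ.*-zeroˡ (g 0)
xPow-⊛ (suc n) g (suc k) = begin
  + 0 * g (suc k) + (coeff (xPow n) ⊛ g) k
    ≡⟨ cong₂ _+_ (ℤ.*-zeroˡ (g (suc k))) (xPow-⊛ n g k) ⟩
  + 0 + shift n g k
    ≡⟨ ℤ.+-identityˡ (shift n g k) ⟩
  shift n g k ∎
  where open ≡-Reasoning

⊛-xPow : ∀ n f → f ⊛ coeff (xPow n) ≗ shift n f
⊛-xPow n f zero    = shift-zero n
  where
  shift-zero : ∀ n → f 0 * coeff (xPow n) 0 ≡ shift n f 0
  shift-zero zero    = ℤ.*-identityʳ (f 0)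
  shift-zero (suc n) = ℤ.*-zeroʳ (f 0)
⊛-xPow n f (suc k) = begin
  f 0 * coeff (xPow n) (suc k) + ((f ∘ suc) ⊛ coeff (xPow n)) k
    ≡⟨ cong (_+_ (f 0 * coeff (xPow n) (suc k))) (⊛-xPow n (f ∘ suc) k) ⟩
  f 0 * coeff (xPow n) (suc k) + shift n (f ∘ suc) k
    ≡⟨ shift-suc n k ⟩
  shift n f (suc k) ∎
  where
  open ≡-Reasoning
  shift-suc : ∀ n k → f 0 * coeff (xPow n) (suc k) + shift n (f ∘ suc) k ≡ shift n f (suc k)
  shift-suc zero          k       =
    trans (cong (_+ f (suc k)) (ℤ.*-zeroʳ (f 0))) (ℤ.+-identityˡ (f (suc k)))
  shift-suc (suc zero)    zero    = trans (ℤ.+-identityʳ _) (ℤ.*-identityʳ (f 0))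
  shift-suc (suc (suc n)) zero    = trans (ℤ.+-identityʳ _) (ℤ.*-zeroʳ (f 0))
  shift-suc (suc n)       (suc k) = shift-suc n k

shift-xPow : ∀ m n → shift m (coeff (xPow n)) ≗ coeff (xPow (m ℕ.+ n))
shift-xPow zero    n k       = refl
shift-xPow (suc m) n zero    = refl
shift-xPow (suc m) n (suc k) = shift-xPow m n k

xPow-⊛-xPow : ∀ m n → coeff (xPow m) ⊛ coeff (xPow n) ≗ coeff (xPow (m ℕ.+ n))
xPow-⊛-xPow m n k = trans (xPow-⊛ m (coeff (xPow n)) k) (shift-xPow m n k)

⊛-cong-≈ : ∀ {m f f′ g g′} → f ≈[ m ] f′ → g ≈[ m ] g′ → f ⊛ g ≈[ m ] f′ ⊛ g′
⊛-cong-≈ {f = f} {f′} {g} {g′} f≈f′ g≈g′ zero =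
  ∣-*-cong (f 0) (f′ 0) (g 0) (g′ 0) (f≈f′ 0) (g≈g′ 0)
⊛-cong-≈ {f = f} {f′} {g} {g′} f≈f′ g≈g′ (suc k) =
  ∣-+-cong (f 0 * g (suc k)) (f′ 0 * g′ (suc k)) _ _
    (∣-*-cong (f 0) (f′ 0) (g (suc k)) (g′ (suc k)) (f≈f′ 0) (g≈g′ (suc k)))
    (⊛-cong-≈ (f≈f′ ∘ suc) g≈g′ k)

⊛-∣ : ∀ {a b f g} → (∀ i → a ∣ f i) → (∀ i → b ∣ g i) → ∀ k → a * b ∣ (f ⊛ g) k
⊛-∣ a∣f b∣g zero    = *-pres-∣ (a∣f 0) (b∣g 0)
⊛-∣ a∣f b∣g (suc k) = ∣m∣n⇒∣m+n (*-pres-∣ (a∣f 0) (b∣g (suc k))) (⊛-∣ (a∣f ∘ suc) b∣g k)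

shift-∣ : ∀ {m f} → (∀ i → m ∣ f i) → ∀ n k → m ∣ shift n f k
shift-∣     m∣f zero    k       = m∣f k
shift-∣ {m} m∣f (suc n) zero    = m∣0 m
shift-∣     m∣f (suc n) (suc k) = shift-∣ m∣f n k

square-xPow+ : ∀ n d → let x = coeff (xPow n) in
  (λ i → x i + d i) ⊛ (λ i → x i + d i) ≗
  (λ k → (coeff (xPow (n ℕ.+ n)) k + shift n d k) + (shift n d k + (d ⊛ d) k))
square-xPow+ n d k = begin
  (x+d ⊛ x+d) k
    ≡⟨ ⊛-distribʳ-+ x d x+d k ⟩
  (x ⊛ x+d) k + (d ⊛ x+d) k
    ≡⟨ cong₂ _+_ (⊛-distribˡ-+ x x d k) (⊛-distribˡ-+ d x d k) ⟩
  ((x ⊛ x) k + (x ⊛ d) k) + ((d ⊛ x) k + (d ⊛ d) k)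
    ≡⟨ cong₂ _+_ (cong₂ _+_ (xPow-⊛-xPow n n k) (xPow-⊛ n d k))
                 (cong (_+ (d ⊛ d) k) (⊛-xPow n d k)) ⟩
  (coeff (xPow (n ℕ.+ n)) k + shift n d k) + (shift n d k + (d ⊛ d) k) ∎
  where
  open ≡-Reasoning
  x x+d : Coeffs
  x = coeff (xPow n)
  x+d i = x i + d i

square-≈-xPow : ∀ {m f} n → m + m ∣ m * m → f ≈[ m ] coeff (xPow n) →
  f ⊛ f ≈[ m + m ] coeff (xPow (n ℕ.+ n))
square-≈-xPow {m} {f} n 2m∣m² f≈xⁿ k = subst (m + m ∣_) (sym difference) divisible
  where
  open ≡-Reasoning
  x d : Coeffs
  x = coeff (xPow n)
  d i = f i - x i
  s t x²ⁿ : ℤ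
  s = shift n d k
  t = (d ⊛ d) k
  x²ⁿ = coeff (xPow (n ℕ.+ n)) k
  f≗x+d : f ≗ (λ i → x i + d i)
  f≗x+d i = split (f i) (x i)
    where
    split : ∀ a b → a ≡ b + (a - b)
    split = solve-∀
  cancel : ∀ a s t → (a + s) + (s + t) - a ≡ (s + s) + t
  cancel = solve-∀
  difference : (f ⊛ f) k - x²ⁿ ≡ (s + s) + t
  difference = begin
    (f ⊛ f) k - x²ⁿ             ≡⟨ cong (_- x²ⁿ) (⊛-cong f≗x+d f≗x+d k) ⟩
    ((λ i → x i + d i) ⊛ (λ i → x i + d i)) k - x²ⁿ
                                ≡⟨ cong (_- x²ⁿ) (square-xPow+ n d k) ⟩
    (x²ⁿ + s) + (s + t) - x²ⁿ   ≡⟨ cancel x²ⁿ s t ⟩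
    (s + s) + t                 ∎
  divisible : m + m ∣ (s + s) + t
  divisible = ∣m∣n⇒∣m+n (∣-double (shift-∣ f≈xⁿ n k)) (∣-trans 2m∣m² (⊛-∣ f≈xⁿ f≈xⁿ k))

coeff-+ₚ : ∀ p q → coeff (p +ₚ q) ≗ (λ k → coeff p k + coeff q k)
coeff-+ₚ []      q       k       = sym (ℤ.+-identityˡ (coeff q k))
coeff-+ₚ (a ∷ p) []      k       = sym (ℤ.+-identityʳ (coeff (a ∷ p) k))
coeff-+ₚ (a ∷ p) (b ∷ q) zero    = refl
coeff-+ₚ (a ∷ p) (b ∷ q) (suc k) = coeff-+ₚ p q k

coeff-·ₚ : ∀ c p → coeff (c ·ₚ p) ≗ (λ k → c * coeff p k)
coeff-·ₚ c []      k       = sym (ℤ.*-zeroʳ c)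
coeff-·ₚ c (a ∷ p) zero    = refl
coeff-·ₚ c (a ∷ p) (suc k) = coeff-·ₚ c p k

coeff-*ₚ : ∀ p q → coeff (p *ₚ q) ≗ coeff p ⊛ coeff q
coeff-*ₚ []      q k       = sym (⊛-zeroˡ (coeff q) k)
coeff-*ₚ (a ∷ p) q zero    = begin
  coeff ((a ·ₚ q) +ₚ (+ 0 ∷ (p *ₚ q))) 0 ≡⟨ coeff-+ₚ (a ·ₚ q) _ 0 ⟩
  coeff (a ·ₚ q) 0 + + 0                 ≡⟨ ℤ.+-identityʳ _ ⟩
  coeff (a ·ₚ q) 0                       ≡⟨ coeff-·ₚ a q 0 ⟩
  a * coeff q 0                          ∎
  where open ≡-Reasoning
coeff-*ₚ (a ∷ p) q (suc k) = begin
  coeff ((a ·ₚ q) +ₚ (+ 0 ∷ (p *ₚ q))) (suc k)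
    ≡⟨ coeff-+ₚ (a ·ₚ q) _ (suc k) ⟩
  coeff (a ·ₚ q) (suc k) + coeff (p *ₚ q) k
    ≡⟨ cong₂ _+_ (coeff-·ₚ a q (suc k)) (coeff-*ₚ p q k) ⟩
  a * coeff q (suc k) + (coeff p ⊛ coeff q) k ∎
  where open ≡-Reasoning

coeff-prodₚ-++ : ∀ ps qs → coeff (prodₚ (ps ++ qs)) ≗ coeff (prodₚ ps) ⊛ coeff (prodₚ qs)
coeff-prodₚ-++ []       qs k = sym (xPow-⊛ 0 (coeff (prodₚ qs)) k)
coeff-prodₚ-++ (p ∷ ps) qs k = begin
  coeff (p *ₚ prodₚ (ps ++ qs)) k
    ≡⟨ coeff-*ₚ p (prodₚ (ps ++ qs)) k ⟩
  (coeff p ⊛ coeff (prodₚ (ps ++ qs))) k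
    ≡⟨ ⊛-cong (λ _ → refl) (coeff-prodₚ-++ ps qs) k ⟩
  (coeff p ⊛ (coeff (prodₚ ps) ⊛ coeff (prodₚ qs))) k
    ≡⟨ ⊛-assoc (coeff p) (coeff (prodₚ ps)) (coeff (prodₚ qs)) k ⟨
  (coeff p ⊛ coeff (prodₚ ps) ⊛ coeff (prodₚ qs)) k
    ≡⟨ ⊛-cong (sym ∘ coeff-*ₚ p (prodₚ ps)) (λ _ → refl) k ⟩
  (coeff (prodₚ (p ∷ ps)) ⊛ coeff (prodₚ qs)) k ∎
  where open ≡-Reasoning

applyUpTo-+ : ∀ {A : Set} (f : ℕ → A) m n →
  applyUpTo f (m ℕ.+ n) ≡ applyUpTo f m ++ applyUpTo (f ∘ (m ℕ.+_)) n
applyUpTo-+ f zero    n = refl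
applyUpTo-+ f (suc m) n = cong (f 0 ∷_) (applyUpTo-+ (f ∘ suc) m n)

prodₚ-cong-≈ : ∀ {m} F G n → (∀ i → coeff (F i) ≈[ m ] coeff (G i)) →
  coeff (prodₚ (applyUpTo F n)) ≈[ m ] coeff (prodₚ (applyUpTo G n))
prodₚ-cong-≈ F G zero    F≈G = ≈-refl {f = coeff oneₚ}
prodₚ-cong-≈ {m} F G (suc n) F≈G = begin
  coeff (F 0 *ₚ prodₚ (applyUpTo (F ∘ suc) n))
    ≈⟨ ≗⇒≈ (coeff-*ₚ (F 0) _) ⟩
  coeff (F 0) ⊛ coeff (prodₚ (applyUpTo (F ∘ suc) n))
    ≈⟨ ⊛-cong-≈ (F≈G 0) (prodₚ-cong-≈ (F ∘ suc) (G ∘ suc) n (F≈G ∘ suc)) ⟩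
  coeff (G 0) ⊛ coeff (prodₚ (applyUpTo (G ∘ suc) n))
    ≈⟨ ≗⇒≈ (coeff-*ₚ (G 0) _) ⟨
  coeff (G 0 *ₚ prodₚ (applyUpTo (G ∘ suc) n)) ∎
  where open ≈-Reasoning (≈-setoid m)

*ₚ-≈-xPow : ∀ {m} p q a b → coeff p ≈[ m ] coeff (xPow a) → coeff q ≈[ m ] coeff (xPow b) →
  coeff (p *ₚ q) ≈[ m ] coeff (xPow (a ℕ.+ b))
*ₚ-≈-xPow {m} p q a b p≈xᵃ q≈xᵇ = begin
  coeff (p *ₚ q)                  ≈⟨ ≗⇒≈ (coeff-*ₚ p q) ⟩
  coeff p ⊛ coeff q               ≈⟨ ⊛-cong-≈ p≈xᵃ q≈xᵇ ⟩
  coeff (xPow a) ⊛ coeff (xPow b) ≈⟨ ≗⇒≈ (xPow-⊛-xPow a b) ⟩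
  coeff (xPow (a ℕ.+ b))          ∎
  where open ≈-Reasoning (≈-setoid m)

≈-quadratic : ∀ {m a₀ a₁ a₂ b₀ b₁ b₂} → m ∣ a₀ - b₀ → m ∣ a₁ - b₁ → m ∣ a₂ - b₂ →
  coeff (a₀ ∷ a₁ ∷ a₂ ∷ []) ≈[ m ] coeff (b₀ ∷ b₁ ∷ b₂ ∷ [])
≈-quadratic     h₀ h₁ h₂ 0                   = h₀
≈-quadratic     h₀ h₁ h₂ 1                   = h₁
≈-quadratic     h₀ h₁ h₂ 2                   = h₂
≈-quadratic {m} h₀ h₁ h₂ (suc (suc (suc k))) = m∣0 m

square-linFactor-shift : ∀ s I j → s + s ∣ s * s →
  coeff (linFactor (s + I) j *ₚ linFactor (s + I) j)
    ≈[ s + s ] coeff (linFactor I j *ₚ linFactor I j)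
square-linFactor-shift s I j 2s∣s² = ≈-quadratic
  (combination (I - j)     (+ 1)   (constant-coeff s I j))
  (combination (j - I - I) (- + 2) (linear-coeff s I j))
  (combination I           (+ 1)   (quadratic-coeff s I j))
  where
  combination : ∀ {z} x y → x * (s + s) + y * (s * s) ≡ z → s + s ∣ z
  combination x y refl = ∣m∣n⇒∣m+n (∣n⇒∣m*n x ∣-refl) (∣n⇒∣m*n y 2s∣s²)
  -- The right-hand sides are the coefficient differences exactly as _*ₚ_ computes them.
  constant-coeff : ∀ s I j → (I - j) * (s + s) + + 1 * (s * s) ≡
    ((j - (s + I)) * (j - (s + I)) + + 0) - ((j - I) * (j - I) + + 0)
  constant-coeff = solve-∀
  linear-coeff : ∀ s I j → (j - I - I) * (s + s) + - + 2 * (s * s) ≡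
    ((j - (s + I)) * (s + I) + ((s + I) * (j - (s + I)) + + 0))
      - ((j - I) * I + (I * (j - I) + + 0))
  linear-coeff = solve-∀
  quadratic-coeff : ∀ s I j → I * (s + s) + + 1 * (s * s) ≡ (s + I) * (s + I) - I * I
  quadratic-coeff = solve-∀

sqFactor-shift : ∀ n i j → + n + + n ∣ + n * + n →
  coeff (sqFactor (n ℕ.+ i) j) ≈[ + n + + n ] coeff (sqFactor i j)
sqFactor-shift n i j 2n∣n² =
  subst (λ I → coeff (linFactor I j *ₚ linFactor I j) ≈[ + n + + n ] coeff (sqFactor i j))
    (sym (ℤ.pos-+ n i)) (square-linFactor-shift (+ n) (+ i) j 2n∣n²)

Prod≈xPow : ℤ → ℕ → Set
Prod≈xPow j n = coeff (prodₚ (applyUpTo (λ i → sqFactor i j) n)) ≈[ + n ] coeff (xPow n)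

prod≈xPow-2 : ∀ j → Odd j → Prod≈xPow j 2
prod≈xPow-2 j (t , refl) =
  *ₚ-≈-xPow (sqFactor 0 j) (sqFactor 1 j *ₚ oneₚ) 0 2
    (*ₚ-≈-xPow (linFactor (+ 0) j) (linFactor (+ 0) j) 0 0 lin₀≈1 lin₀≈1)
    (*ₚ-≈-xPow (sqFactor 1 j) oneₚ 2 0
      (*ₚ-≈-xPow (linFactor (+ 1) j) (linFactor (+ 1) j) 1 1 lin₁≈x lin₁≈x)
      (≈-refl {f = coeff oneₚ}))
  where
  lin₀≈1 : coeff (linFactor (+ 0) j) ≈[ + 2 ] coeff (xPow 0)
  lin₀≈1 zero          = divides t (even-part t)
    where
    even-part : ∀ t → (+ 2 * t + + 1 - + 0) - + 1 ≡ t * + 2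
    even-part = solve-∀
  lin₀≈1 (suc zero)    = m∣0 (+ 2)
  lin₀≈1 (suc (suc k)) = m∣0 (+ 2)
  lin₁≈x : coeff (linFactor (+ 1) j) ≈[ + 2 ] coeff (xPow 1)
  lin₁≈x zero          = divides t (even-part t)
    where
    even-part : ∀ t → (+ 2 * t + + 1 - + 1) - + 0 ≡ t * + 2
    even-part = solve-∀
  lin₁≈x (suc zero)    = m∣0 (+ 2)
  lin₁≈x (suc (suc k)) = m∣0 (+ 2)

prod≈xPow-double : ∀ j n → + n + + n ∣ + n * + n → Prod≈xPow j n → Prod≈xPow j (n ℕ.+ n)
prod≈xPow-double j n 2n∣n² prod≈xⁿ =
  subst (λ m → coeff (prodₚ (applyUpTo F (n ℕ.+ n))) ≈[ m ] coeff (xPow (n ℕ.+ n)))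
    (sym (ℤ.pos-+ n n)) (begin
    coeff (prodₚ (applyUpTo F (n ℕ.+ n)))
      ≡⟨ cong (coeff ∘ prodₚ) (applyUpTo-+ F n n) ⟩
    coeff (prodₚ (applyUpTo F n ++ applyUpTo (F ∘ (n ℕ.+_)) n))
      ≈⟨ ≗⇒≈ (coeff-prodₚ-++ (applyUpTo F n) _) ⟩
    A ⊛ coeff (prodₚ (applyUpTo (F ∘ (n ℕ.+_)) n))
      ≈⟨ ⊛-cong-≈ (≈-refl {f = A}) (prodₚ-cong-≈ _ F n (λ i → sqFactor-shift n i j 2n∣n²)) ⟩
    A ⊛ A
      ≈⟨ square-≈-xPow n 2n∣n² prod≈xⁿ ⟩
    coeff (xPow (n ℕ.+ n)) ∎)
  where
  F : ℕ → Poly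
  F i = sqFactor i j
  A : Coeffs
  A = coeff (prodₚ (applyUpTo F n))
  open ≈-Reasoning (≈-setoid (+ n + + n))

double∣square-of-even : ∀ k → let m = + (2 ℕ.* k) in m + m ∣ m * m
double∣square-of-even k =
  subst (λ m → m + m ∣ m * m) (sym (ℤ.pos-* 2 k)) (divides (+ k) (identity (+ k)))
  where
  identity : ∀ k → (+ 2 * k) * (+ 2 * k) ≡ k * ((+ 2 * k) + (+ 2 * k))
  identity = solve-∀

prod≈xPow-2^ : ∀ j → Odd j → ∀ r → Prod≈xPow j (2 ^ suc r)
prod≈xPow-2^ j odd zero    = prod≈xPow-2 j odd
prod≈xPow-2^ j odd (suc r) =
  subst (Prod≈xPow j) (cong (2 ^ suc r ℕ.+_) (sym (ℕ.+-identityʳ (2 ^ suc r))))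
    (prod≈xPow-double j (2 ^ suc r) (double∣square-of-even (2 ^ r)) (prod≈xPow-2^ j odd r))

mainTheorem12 : (q : ℕ) → 1 ≤ q → (j : ℤ) → Odd j →
    prodₚ (map (λ i → sqFactor i j) (upTo (2 ^ q))) ≡ xPow (2 ^ q) [modₚ (+ (2 ^ q)) ]
mainTheorem12 zero    ()
mainTheorem12 (suc r) _ j odd k
  rewrite map-upTo (λ i → sqFactor i j) (2 ^ suc r) = ∣⇒∣ᵤ (prod≈xPow-2^ j odd r k)
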